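{- Let $C_n$ denote the binary code generated by $[I_n|A]$ where $A$ is the adjacency matrix of the complete graph $K_n$. Then $C_4$ and $C_8$ are extremal Type II self-dual codes, and $C_6$ is an extremal Type I self-dual code.
   Context: The code generated by a matrix over $\mathbb{F}_2$ is its row space. A binary code $C$ is self-dual if $C=C^\perp$; it is Type II if all codeword weights are divisible by $4$, Type I otherwise. A self-dual code of length $N$ is extremal if its minimum distance attains the bound $4\lfloor N/24\rfloor+4$ (for Type II, and for Type I with $N\not\equiv 22\pmod{24}$), resp. $4\lfloor N/24\rfloor+6$ for Type I with $N\equiv 22\pmod{24}$. -}

module Defs where

open import Data.Bool using (Bool; true; false; not; _xor_; _∧_; if_then_else_)
import Data.Nat.Properties as ℕ
open import Data.Nat using (ℕ; zero; suc; _+_; _*_; _≤_; _/_)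
open import Data.Nat.Divisibility using (_∣_)
open import Data.Nat.DivMod using (_%_)
open import Data.Fin using (Fin; splitAt)
open import Data.Fin.Properties using (_≟_)
open import Data.Sum using (inj₁; inj₂)
open import Data.Product using (Σ; _×_; ∃)
open import Relation.Nullary using (¬_; does)
open import Relation.Binary.PropositionalEquality using (_≡_)

-- Binary words of length N over F₂ (Bool with xor as addition, ∧ as product).
Word : ℕ → Set
Word N = Fin N → Bool

zeroWord : ∀ {N} → Word N
zeroWord _ = false

_⊕_ : ∀ {N} → Word N → Word N → Word N
(u ⊕ v) j = u j xor v j

sumF2 : ∀ {k} → (Fin k → Bool) → Bool
sumF2 {zero} f = false
sumF2 {suc k} f = f Fin.zero xor sumF2 (λ i → f (Fin.suc i))
  where import Data.Fin as Fin

Matrix : ℕ → ℕ → Set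
Matrix m N = Fin m → Fin N → Bool

lincomb : ∀ {m N} → Matrix m N → (Fin m → Bool) → Word N
lincomb G c j = sumF2 (λ i → c i ∧ G i j)

Code : ℕ → Set₁
Code N = Word N → Set

rowSpace : ∀ {m N} → Matrix m N → Code N
rowSpace G w = ∃ λ c → ∀ j → w j ≡ lincomb G c j

inner : ∀ {N} → Word N → Word N → Bool
inner u v = sumF2 (λ j → u j ∧ v j)

dual : ∀ {N} → Code N → Code N
dual C v = ∀ w → C w → inner v w ≡ false

SelfDual : ∀ {N} → Code N → Set
SelfDual C = (∀ w → C w → dual C w) × (∀ w → dual C w → C w)

weight : ∀ {N} → Word N → ℕ
weight {zero} w = 0
weight {suc N} w = (if w Fin.zero then 1 else 0) + weight (λ j → w (Fin.suc j))
  where import Data.Fin as Fin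

MinDist : ∀ {N} → Code N → ℕ → Set
MinDist C d =
  (Σ _ λ w → C w × ¬ (∀ j → w j ≡ false) × weight w ≡ d) ×
  (∀ w → C w → ¬ (∀ j → w j ≡ false) → d ≤ weight w)

TypeII : ∀ {N} → Code N → Set
TypeII C = SelfDual C × (∀ w → C w → 4 ∣ weight w)

TypeI : ∀ {N} → Code N → Set
TypeI C = SelfDual C × ¬ (∀ w → C w → 4 ∣ weight w)

extremalBound : Bool → ℕ → ℕ    -- first argument: true = Type II
extremalBound true  N = 4 * (N / 24) + 4
extremalBound false N =
  if does (N % 24 ℕ.≟ 22) then 4 * (N / 24) + 6 else 4 * (N / 24) + 4

ExtremalTypeII : ∀ {N} → Code N → Set
ExtremalTypeII {N} C = TypeII C × MinDist C (extremalBound true N)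

ExtremalTypeI : ∀ {N} → Code N → Set
ExtremalTypeI {N} C = TypeI C × MinDist C (extremalBound false N)

adjK : (n : ℕ) → Matrix n n
adjK n i j = not (does (i ≟ j))

genK : (n : ℕ) → Matrix n (n + n)
genK n i j with splitAt n j
... | inj₁ k = does (i ≟ k)
... | inj₂ k = adjK n i k

Cn : (n : ℕ) → Code (n + n)
Cn n = rowSpace (genK n)

-- The adjacency matrix A = J - I of K_n is symmetric and, over F₂ with n even,
-- A² = (n - 2) J + I = I; so A is orthogonal. For any orthogonal A the rows of
-- [I | A] are pairwise orthogonal (G Gᵀ = I + A Aᵀ = 0), and a word orthogonal
-- to all rows is already determined by its first half x: its second half must
-- be x A. Hence [I | A] generates a self-dual code. For n = 4, 6, 8 the
-- orthogonality of A is checked entrywise, and the weight conditions by running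
-- over all 2ⁿ codewords.
module Submission where

open import Defs
open import Algebra.Bundles using (CommutativeRing)
import Algebra.Properties.Semiring.Sum as SemiringSum
open import Data.Bool using (Bool; true; false; _xor_; _∧_; if_then_else_)
import Data.Bool.Properties as Bool
open import Data.Bool.Properties
  using (xor-∧-commutativeRing; xor-same; xor-assoc; xor-identityʳ; ∧-comm; ∧-assoc; ∧-zeroʳ)
open import Data.Fin using (Fin; zero; suc; _↑ˡ_; _↑ʳ_; splitAt; join)
open import Data.Fin.Properties using (_≟_; all?; splitAt-↑ˡ; splitAt-↑ʳ; join-splitAt)
open import Data.Fin.Subset using (Subset)
open import Data.Fin.Subset.Properties using (anySubset?)
open import Data.Nat using (ℕ; _+_; _≤_; _≤?_)
import Data.Nat.Properties as ℕ
open import Data.Nat.Divisibility using (_∣_; _∣?_)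
open import Data.Product using (_×_; _,_; ∃)
open import Data.Sum using (inj₁; inj₂)
open import Data.Vec using (lookup; tabulate)
open import Data.Vec.Properties using (lookup∘tabulate)
open import Data.Vec.Functional using (take; drop)
open import Function using (_∘_)
open import Relation.Binary.Definitions using (_Respects_)
open import Relation.Binary.PropositionalEquality
open import Relation.Nullary using (¬_; Dec; yes; no; does; ¬?; contradiction)
open import Relation.Nullary.Decidable
  using (map′; from-yes; from-no; decidable-stable; _×-dec_; _→-dec_)
open import Relation.Unary using (Pred; Decidable)

open SemiringSum (CommutativeRing.semiring xor-∧-commutativeRing)
  using (sum; ∑-comm; *-distribˡ-sum; *-distribʳ-sum; sum-replicate-zero)

private
  variable
    k m n N : ℕ

sumF2≡sum : (f : Fin k → Bool) → sumF2 f ≡ sum f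
sumF2≡sum {ℕ.zero} f = refl
sumF2≡sum {ℕ.suc k} f = cong (f zero xor_) (sumF2≡sum (f ∘ suc))

sumF2-cong : {f g : Fin k → Bool} → f ≗ g → sumF2 f ≡ sumF2 g
sumF2-cong {ℕ.zero} f≗g = refl
sumF2-cong {ℕ.suc k} f≗g = cong₂ _xor_ (f≗g zero) (sumF2-cong (f≗g ∘ suc))

sumF2-false : ∀ k → sumF2 {k} (λ _ → false) ≡ false
sumF2-false k = trans (sumF2≡sum {k} (λ _ → false)) (sum-replicate-zero k)

∧-distribˡ-sumF2 : ∀ b (f : Fin k → Bool) → b ∧ sumF2 f ≡ sumF2 (λ i → b ∧ f i)
∧-distribˡ-sumF2 b f = begin
  b ∧ sumF2 f              ≡⟨ cong (b ∧_) (sumF2≡sum f) ⟩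
  b ∧ sum f                ≡⟨ *-distribˡ-sum b f ⟩
  sum (λ i → b ∧ f i)      ≡⟨ sumF2≡sum (λ i → b ∧ f i) ⟨
  sumF2 (λ i → b ∧ f i)    ∎
  where open ≡-Reasoning

∧-distribʳ-sumF2 : ∀ b (f : Fin k → Bool) → sumF2 f ∧ b ≡ sumF2 (λ i → f i ∧ b)
∧-distribʳ-sumF2 b f = begin
  sumF2 f ∧ b              ≡⟨ cong (_∧ b) (sumF2≡sum f) ⟩
  sum f ∧ b                ≡⟨ *-distribʳ-sum b f ⟩
  sum (λ i → f i ∧ b)      ≡⟨ sumF2≡sum (λ i → f i ∧ b) ⟨
  sumF2 (λ i → f i ∧ b)    ∎
  where open ≡-Reasoning

sumF2-comm : (f : Fin m → Fin k → Bool) →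
             sumF2 (λ i → sumF2 (f i)) ≡ sumF2 (λ j → sumF2 (λ i → f i j))
sumF2-comm f = begin
  sumF2 (λ i → sumF2 (f i))          ≡⟨ sumF2-cong (sumF2≡sum ∘ f) ⟩
  sumF2 (λ i → sum (f i))            ≡⟨ sumF2≡sum (λ i → sum (f i)) ⟩
  sum (λ i → sum (f i))              ≡⟨ ∑-comm f ⟩
  sum (λ j → sum (λ i → f i j))      ≡⟨ sumF2≡sum (λ j → sum (λ i → f i j)) ⟨
  sumF2 (λ j → sum (λ i → f i j))    ≡⟨ sumF2-cong (λ j → sumF2≡sum (λ i → f i j)) ⟨
  sumF2 (λ j → sumF2 (λ i → f i j))  ∎
  where open ≡-Reasoning

sumF2-split : ∀ n (f : Fin (n + m) → Bool) → sumF2 f ≡ sumF2 (take n f) xor sumF2 (drop n f)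
sumF2-split ℕ.zero f = refl
sumF2-split (ℕ.suc n) f =
  trans (cong (f zero xor_) (sumF2-split n (f ∘ suc))) (sym (xor-assoc (f zero) _ _))

≗-from-halves : {u v : Word (n + m)} → take n u ≗ take n v → drop n u ≗ drop n v → u ≗ v
≗-from-halves {n} {m} {u} {v} take≗ drop≗ q =
  subst (λ q → u q ≡ v q) (join-splitAt n m q) (on-part (splitAt n q))
  where
  on-part : ∀ s → u (join n m s) ≡ v (join n m s)
  on-part (inj₁ j) = take≗ j
  on-part (inj₂ k) = drop≗ k

inner-cong : {u u′ v v′ : Word N} → u ≗ u′ → v ≗ v′ → inner u v ≡ inner u′ v′
inner-cong u≗ v≗ = sumF2-cong (λ j → cong₂ _∧_ (u≗ j) (v≗ j))

inner-sym : (u v : Word N) → inner u v ≡ inner v u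
inner-sym u v = sumF2-cong (λ j → ∧-comm (u j) (v j))

inner-falseʳ : (u : Word N) → inner u (λ _ → false) ≡ false
inner-falseʳ {N} u = trans (sumF2-cong (∧-zeroʳ ∘ u)) (sumF2-false N)

inner-split : ∀ n (u v : Word (n + m)) →
              inner u v ≡ inner (take n u) (take n v) xor inner (drop n u) (drop n v)
inner-split n u v = sumF2-split n _

-- lincomb G c j is definitionally inner c (λ i → G i j).
inner-lincomb : (G : Matrix m N) (c : Fin m → Bool) (w : Word N) →
                inner (lincomb G c) w ≡ inner c (λ i → inner (G i) w)
inner-lincomb G c w = begin
  sumF2 (λ j → sumF2 (λ i → c i ∧ G i j) ∧ w j)
    ≡⟨ sumF2-cong (λ j → ∧-distribʳ-sumF2 (w j) (λ i → c i ∧ G i j)) ⟩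
  sumF2 (λ j → sumF2 (λ i → (c i ∧ G i j) ∧ w j))
    ≡⟨ sumF2-comm (λ j i → (c i ∧ G i j) ∧ w j) ⟩
  sumF2 (λ i → sumF2 (λ j → (c i ∧ G i j) ∧ w j))
    ≡⟨ sumF2-cong (λ i → sumF2-cong (λ j → ∧-assoc (c i) (G i j) (w j))) ⟩
  sumF2 (λ i → sumF2 (λ j → c i ∧ (G i j ∧ w j)))
    ≡⟨ sumF2-cong (λ i → ∧-distribˡ-sumF2 (c i) (λ j → G i j ∧ w j)) ⟨
  sumF2 (λ i → c i ∧ inner (G i) w)
    ∎
  where open ≡-Reasoning

lincomb-⟂ : (G : Matrix m N) {w : Word N} → (∀ i → inner (G i) w ≡ false) →
            ∀ c → inner (lincomb G c) w ≡ false
lincomb-⟂ G G⟂w c =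
  trans (inner-lincomb G c _) (trans (inner-cong (λ _ → refl) G⟂w) (inner-falseʳ c))

I : Matrix n n
I i j = does (i ≟ j)

transpose : Matrix m N → Matrix N m
transpose A i j = A j i

_∙_ : Matrix m k → Matrix k N → Matrix m N
(A ∙ B) i = lincomb B (A i)

I-sym : (i j : Fin n) → I i j ≡ I j i
I-sym i j with i ≟ j | j ≟ i
... | yes _   | yes _   = refl
... | no _    | no _    = refl
... | yes i≡j | no j≢i  = contradiction (sym i≡j) j≢i
... | no i≢j  | yes j≡i = contradiction (sym j≡i) i≢j

inner-Iˡ : (i : Fin n) (v : Word n) → inner (I i) v ≡ v i
inner-Iˡ {ℕ.suc n} zero v = trans (cong (v zero xor_) (sumF2-false n)) (xor-identityʳ (v zero))
inner-Iˡ (suc i) v = inner-Iˡ i (v ∘ suc)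

inner-Iʳ : (v : Word n) (i : Fin n) → inner v (I i) ≡ v i
inner-Iʳ v i = trans (inner-sym v (I i)) (inner-Iˡ i v)

lincomb-I : (c : Fin n → Bool) → lincomb I c ≗ c
lincomb-I c j = trans (inner-cong (λ _ → refl) (λ i → I-sym i j)) (inner-Iʳ c j)

lincomb-∙ : (A : Matrix m k) (B : Matrix k N) (c : Fin m → Bool) →
            lincomb B (lincomb A c) ≗ lincomb (A ∙ B) c
lincomb-∙ A B c j = inner-lincomb A c (λ l → B l j)

row∈rowSpace : (G : Matrix m N) (i : Fin m) → rowSpace G (G i)
row∈rowSpace G i = I i , λ j → sym (inner-Iˡ i (λ l → G l j))

Orthogonal : Matrix n n → Set
Orthogonal A = (∀ i → (A ∙ transpose A) i ≗ I i) × (∀ i → (transpose A ∙ A) i ≗ I i)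

orthogonal? : Decidable (Orthogonal {n})
orthogonal? _ = all? (λ i → all? (λ j → _ Bool.≟ _))
          ×-dec all? (λ i → all? (λ j → _ Bool.≟ _))

rowSpace-selfOrthogonal : (G : Matrix m N) → (∀ i i′ → inner (G i) (G i′) ≡ false) →
                          ∀ w → rowSpace G w → dual (rowSpace G) w
rowSpace-selfOrthogonal G G⟂G w (c , w≗) w′ (c′ , w′≗) =
  trans (inner-cong w≗ (λ _ → refl)) (lincomb-⟂ G G⟂w′ c)
  where
  G⟂w′ : ∀ i → inner (G i) w′ ≡ false
  G⟂w′ i = trans (inner-sym (G i) w′)
                 (trans (inner-cong w′≗ (λ _ → refl)) (lincomb-⟂ G (λ i′ → G⟂G i′ i) c′))

record IsStandardForm (G : Matrix n (n + n)) (A : Matrix n n) : Set where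
  field
    take-block : ∀ i → take n (G i) ≗ I i
    drop-block : ∀ i → drop n (G i) ≗ A i

genK-standardForm : ∀ n → IsStandardForm (genK n) (adjK n)
genK-standardForm n = record { take-block = take-block ; drop-block = drop-block }
  where
  take-block : ∀ i j → genK n i (j ↑ˡ n) ≡ I i j
  take-block i j rewrite splitAt-↑ˡ n j n = refl
  drop-block : ∀ i k → genK n i (n ↑ʳ k) ≡ adjK n i k
  drop-block i k rewrite splitAt-↑ʳ n n k = refl

module StandardForm {G : Matrix n (n + n)} {A : Matrix n n} (G-std : IsStandardForm G A) where
  open IsStandardForm G-std

  lincomb-take : (c : Fin n → Bool) → take n (lincomb G c) ≗ c
  lincomb-take c j = trans (inner-cong (λ _ → refl) (λ i → take-block i j)) (lincomb-I c j)

  lincomb-drop : (c : Fin n → Bool) → drop n (lincomb G c) ≗ lincomb A c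
  lincomb-drop c k = inner-cong (λ _ → refl) (λ i → drop-block i k)

  rows-orthogonal : (∀ i → (A ∙ transpose A) i ≗ I i) → ∀ i i′ → inner (G i) (G i′) ≡ false
  rows-orthogonal AAᵀ≗I i i′ = begin
    inner (G i) (G i′)
      ≡⟨ inner-split n (G i) (G i′) ⟩
    inner (take n (G i)) (take n (G i′)) xor inner (drop n (G i)) (drop n (G i′))
      ≡⟨ cong₂ _xor_ (inner-cong (take-block i) (take-block i′))
                     (inner-cong (drop-block i) (drop-block i′)) ⟩
    inner (I i) (I i′) xor inner (A i) (A i′)
      ≡⟨ cong₂ _xor_ (inner-Iˡ i (I i′)) (AAᵀ≗I i i′) ⟩
    I i′ i xor I i i′
      ≡⟨ cong (_xor I i i′) (I-sym i′ i) ⟩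
    I i i′ xor I i i′
      ≡⟨ xor-same (I i i′) ⟩
    false
      ∎
    where open ≡-Reasoning

  dual⊆rowSpace : (∀ i → (transpose A ∙ A) i ≗ I i) → ∀ v → dual (rowSpace G) v → rowSpace G v
  dual⊆rowSpace AᵀA≗I v v⟂ = x , ≗-from-halves (sym ∘ lincomb-take x) (sym ∘ drop≗)
    where
    x y : Word n
    x = take n v
    y = drop n v

    x≗yAᵀ : x ≗ lincomb (transpose A) y
    x≗yAᵀ i = xor≡false⇒≡ _ _ (begin
      x i xor inner y (A i)
        ≡⟨ cong₂ _xor_ (inner-Iʳ x i) refl ⟨
      inner x (I i) xor inner y (A i)
        ≡⟨ cong₂ _xor_ (inner-cong (λ _ → refl) (take-block i))
                       (inner-cong (λ _ → refl) (drop-block i)) ⟨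
      inner x (take n (G i)) xor inner y (drop n (G i))
        ≡⟨ inner-split n v (G i) ⟨
      inner v (G i)
        ≡⟨ v⟂ (G i) (row∈rowSpace G i) ⟩
      false
        ∎)
      where
      open ≡-Reasoning
      xor≡false⇒≡ : ∀ a b → a xor b ≡ false → a ≡ b
      xor≡false⇒≡ false false _ = refl
      xor≡false⇒≡ true  true  _ = refl
      xor≡false⇒≡ false true  ()
      xor≡false⇒≡ true  false ()

    drop≗ : drop n (lincomb G x) ≗ y
    drop≗ k = begin
      drop n (lincomb G x) k                ≡⟨ lincomb-drop x k ⟩
      lincomb A x k                         ≡⟨ inner-cong x≗yAᵀ (λ _ → refl) ⟩
      lincomb A (lincomb (transpose A) y) k ≡⟨ lincomb-∙ (transpose A) A y k ⟩
      lincomb (transpose A ∙ A) y k         ≡⟨ inner-cong (λ _ → refl) (λ l → AᵀA≗I l k) ⟩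
      lincomb I y k                         ≡⟨ lincomb-I y k ⟩
      y k                                   ∎
      where open ≡-Reasoning

  selfDual : Orthogonal A → SelfDual (rowSpace G)
  selfDual (AAᵀ≗I , AᵀA≗I) =
    rowSpace-selfOrthogonal G (rows-orthogonal AAᵀ≗I) , dual⊆rowSpace AᵀA≗I

Cn-selfDual : ∀ n → Orthogonal (adjK n) → SelfDual (Cn n)
Cn-selfDual n = StandardForm.selfDual (genK-standardForm n)

allSubset? : ∀ {q} {Q : Pred (Subset n) q} → Decidable Q → Dec (∀ s → Q s)
allSubset? Q? = map′ (λ ∄¬Q s → decidable-stable (Q? s) (∄¬Q ∘ (s ,_)))
                     (λ ∀Q (s , ¬Qs) → ¬Qs (∀Q s))
                     (¬? (anySubset? (¬? ∘ Q?)))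

rowSpace⇒subset : (G : Matrix m N) {w : Word N} → rowSpace G w → ∃ λ s → lincomb G (lookup s) ≗ w
rowSpace⇒subset G (c , w≗) =
  tabulate c , λ j → trans (inner-cong (lookup∘tabulate c) (λ _ → refl)) (sym (w≗ j))

module _ (G : Matrix m N) {p} {P : Pred (Word N) p}
         (P-resp : P Respects _≗_) (P? : Decidable P) where

  all-codewords? : Dec (∀ w → rowSpace G w → P w)
  all-codewords? = map′
    (λ ∀P w w∈G → let (s , s≗w) = rowSpace⇒subset G w∈G in P-resp s≗w (∀P s))
    (λ ∀P s → ∀P _ (lookup s , λ _ → refl))
    (allSubset? (P? ∘ lincomb G ∘ lookup))

  any-codeword? : Dec (∃ λ w → rowSpace G w × P w)
  any-codeword? = map′
    (λ (s , Ps) → _ , (lookup s , λ _ → refl) , Ps)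
    (λ (w , w∈G , Pw) → let (s , s≗w) = rowSpace⇒subset G w∈G
                         in s , P-resp (sym ∘ s≗w) Pw)
    (anySubset? (P? ∘ lincomb G ∘ lookup))

weight-cong : {u v : Word N} → u ≗ v → weight u ≡ weight v
weight-cong {ℕ.zero} u≗v = refl
weight-cong {ℕ.suc N} u≗v =
  cong₂ _+_ (cong (λ b → if b then 1 else 0) (u≗v zero)) (weight-cong (u≗v ∘ suc))

IsZero : Pred (Word N) _
IsZero w = ∀ j → w j ≡ false

isZero? : Decidable (IsZero {N})
isZero? w = all? (λ j → w j Bool.≟ false)

IsZero-resp : (IsZero {N}) Respects _≗_
IsZero-resp u≗v u≡0 j = trans (sym (u≗v j)) (u≡0 j)

weightsDivisibleBy? : ∀ d (G : Matrix m N) → Dec (∀ w → rowSpace G w → d ∣ weight w)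
weightsDivisibleBy? d G =
  all-codewords? G (λ u≗v → subst (d ∣_) (weight-cong u≗v)) (λ w → d ∣? weight w)

minDist? : (G : Matrix m N) (d : ℕ) → Dec (MinDist (rowSpace G) d)
minDist? G d =
        any-codeword? G nonzero-of-weight-resp (λ w → ¬? (isZero? w) ×-dec weight w ℕ.≟ d)
  ×-dec all-codewords? G lower-bound-resp (λ w → ¬? (isZero? w) →-dec d ≤? weight w)
  where
  nonzero-of-weight-resp : (λ w → ¬ IsZero w × weight w ≡ d) Respects _≗_
  nonzero-of-weight-resp u≗v (u≢0 , ∣u∣≡d) =
    u≢0 ∘ IsZero-resp (sym ∘ u≗v) , trans (sym (weight-cong u≗v)) ∣u∣≡d
  lower-bound-resp : (λ w → ¬ IsZero w → d ≤ weight w) Respects _≗_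
  lower-bound-resp u≗v bound v≢0 =
    subst (d ≤_) (weight-cong u≗v) (bound (v≢0 ∘ IsZero-resp u≗v))

mainTheorem13 : ExtremalTypeII (Cn 4) × ExtremalTypeII (Cn 8) × ExtremalTypeI (Cn 6)
mainTheorem13 =
  ((Cn-selfDual 4 (from-yes (orthogonal? (adjK 4))) , from-yes (weightsDivisibleBy? 4 (genK 4))) ,
   from-yes (minDist? (genK 4) 4)) ,
  ((Cn-selfDual 8 (from-yes (orthogonal? (adjK 8))) , from-yes (weightsDivisibleBy? 4 (genK 8))) ,
   from-yes (minDist? (genK 8) 4)) ,
  ((Cn-selfDual 6 (from-yes (orthogonal? (adjK 6))) , from-no (weightsDivisibleBy? 4 (genK 6))) ,
   from-yes (minDist? (genK 6) 4))
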